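{- Let $G$ be a connected graph on $n$ vertices with minimum degree $\delta \geq 4$. Then $rc(G) \leq \dfrac{16n}{\delta}$.
   Context: An edge colouring of a graph $G$ is called rainbow if between any two vertices of $G$ there is a path all of whose edges have distinct colours. The rainbow connectivity $rc(G)$ of a connected graph $G$ is the minimum number of colours in a rainbow edge colouring of $G$. -}

module Defs where

open import Data.Nat using (ℕ; zero; suc; _+_; _*_; _≤_)
open import Data.Fin using (Fin)
open import Data.Bool using (Bool; true; false; T; if_then_else_)
open import Data.List using (List; []; _∷_; map; allFin)
open import Data.Nat.ListAction using (sum)
open import Data.List.Relation.Unary.Unique.Propositional using (Unique)
open import Data.Product using (Σ; ∃; _×_; _,_)
open import Relation.Binary.PropositionalEquality using (_≡_)

record Graph (n : ℕ) : Set where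
  field
    adj     : Fin n → Fin n → Bool
    adj-sym : ∀ u v → adj u v ≡ adj v u
    irrefl  : ∀ v → adj v v ≡ false

open Graph public

Adj : ∀ {n} → Graph n → Fin n → Fin n → Set
Adj G u v = T (adj G u v)

data Walk {n : ℕ} (G : Graph n) : Fin n → Fin n → Set where
  nil  : ∀ {u} → Walk G u u
  cons : ∀ {u w v} → Adj G u w → Walk G w v → Walk G u v

vertices : ∀ {n} {G : Graph n} {u v} → Walk G u v → List (Fin n)
vertices {u = u} nil = u ∷ []
vertices {u = u} (cons _ p) = u ∷ vertices p

IsPath : ∀ {n} {G : Graph n} {u v} → Walk G u v → Set
IsPath p = Unique (vertices p)

Connected : ∀ {n} → Graph n → Set
Connected G = ∀ u v → Σ (Walk G u v) IsPath

degree : ∀ {n} → Graph n → Fin n → ℕ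
degree {n} G v = sum (map (λ u → if adj G v u then 1 else 0) (allFin n))

IsMinDegree : ∀ {n} → Graph n → ℕ → Set
IsMinDegree G δ = (∀ v → δ ≤ degree G v) × ∃ (λ v → degree G v ≡ δ)

-- An edge colouring with k colours: a colour for each ordered pair, symmetric on edges
-- (values on non-edges are irrelevant).
record EdgeColouring {n : ℕ} (G : Graph n) (k : ℕ) : Set where
  field
    col     : Fin n → Fin n → Fin k
    col-sym : ∀ u v → Adj G u v → col u v ≡ col v u

open EdgeColouring public

edgeColours : ∀ {n k} {G : Graph n} → EdgeColouring G k → ∀ {u v} → Walk G u v → List (Fin k)
edgeColours c nil = []
edgeColours c (cons {u} {w} _ p) = col c u w ∷ edgeColours c p

IsRainbow : ∀ {n k} {G : Graph n} → EdgeColouring G k → Set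
IsRainbow {G = G} c = ∀ u v → Σ (Walk G u v) (λ p → IsPath p × Unique (edgeColours c p))

RcAtMost : ∀ {n} → Graph n → ℕ → Set
RcAtMost G m = Σ ℕ (λ k → k ≤ m × Σ (EdgeColouring G k) IsRainbow)

-- A set D spanned by a tree of G is grown greedily, one to three vertices at a time, so that every
-- added vertex newly dominates at least (δ - 1)/3 vertices, until every vertex is within distance
-- 2 of D, every vertex at distance 2 has two neighbours at distance 1, and every vertex at distance
-- 1 has two neighbours in D or a neighbour at distance 1. Hence |D| - 1 ≤ 3n/(δ - 1).
-- Ranking the vertices of D in grafting order, the tree edges get |D| - 1 colours and any two
-- vertices of D are joined by a rainbow walk inside D. Five further colours, two of each parity
-- true/false and one neutral, go on the edges towards D, using a 2-colouring χ of the distance-1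
-- vertices in which every such vertex with a neighbour at distance 1 has one of the other colour
-- (a maximal independent set). Every vertex v then has a parity and two routes into D: one using
-- only colours of its own parity and one avoiding the colours of any prescribed parity. The route
-- of u, a tree walk and the reversed parity-avoiding route of v form a rainbow walk from u to v,
-- which shortcuts to a rainbow path. So rc(G) ≤ |D| + 4 ≤ 16n/δ when δ ≥ 4.

module Submission where

open import Defs
open import Data.Bool using (Bool; true; false; T; if_then_else_; not)
open import Data.Bool.Properties using (¬-not) renaming (_≟_ to _≟ᵇ_)
open import Data.Empty using (⊥)
open import Data.Fin using (Fin; zero; suc; _≟_; toℕ; fromℕ<)
open import Data.Fin.Properties using (suc-injective; any?; toℕ-fromℕ<; toℕ-injective)
open import Data.List using (List; []; _∷_; _++_; length; map; tabulate; allFin)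
open import Data.List.Properties using (map-tabulate)
open import Data.List.Membership.Propositional using (_∈_; _∉_; find; lose)
open import Data.List.Membership.Propositional.Properties using (∈-++⁻; ∈-length; ∈-allFin)
open import Data.List.Relation.Binary.Sublist.Propositional using (_⊆_; []; _∷_; _∷ʳ_; ⊆-refl; ⊆-trans)
open import Data.List.Relation.Binary.Sublist.Propositional.Properties using (All-resp-⊆)
open import Data.List.Relation.Unary.All as All using (All; []; _∷_)
open import Data.List.Relation.Unary.All.Properties using (¬Any⇒All¬)
open import Data.List.Relation.Unary.AllPairs using ([]; _∷_)
open import Data.List.Relation.Unary.Any as Any using (Any; here; there)
open import Data.List.Relation.Unary.Unique.Propositional using (Unique)
import Data.List.Relation.Unary.Unique.Propositional.Properties as Unique
open import Data.Nat using (ℕ; zero; suc; _+_; _*_; _∸_; _⊔_; _≤_; _<_; z≤n; s≤s)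
open import Data.Nat.ListAction using (sum)
open import Data.Nat.Properties hiding (_≟_; suc-injective)
open import Data.Nat.Tactic.RingSolver using (solve-∀)
open import Data.Product using (Σ; ∃; ∃₂; ∃-syntax; _×_; _,_; proj₁; proj₂)
open import Data.Sum using (_⊎_; inj₁; inj₂)
open import Function using (_∘_; id; case_of_)
open import Level using (Level; 0ℓ)
open import Relation.Binary.PropositionalEquality
open import Relation.Nullary using (¬_; Dec; yes; no; does; contradiction; _×-dec_; _⊎-dec_; ¬?)
open import Relation.Nullary.Decidable using (T?; dec-true; dec-false; decidable-stable)
open import Relation.Unary using (Pred; Decidable)
open import Relation.Unary.Properties using (_∩?_; ∁?)

private
  variable
    ℓ : Level
    A : Set

indicator : ∀ {P : Set ℓ} → Dec P → ℕ
indicator P? = if does P? then 1 else 0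

count : ∀ {n} {P : Pred (Fin n) ℓ} → Decidable P → ℕ
count P? = sum (tabulate (indicator ∘ P?))

count≤n : ∀ {n} {P : Pred (Fin n) ℓ} (P? : Decidable P) → count P? ≤ n
count≤n {n = zero} P? = z≤n
count≤n {n = suc n} P? with P? zero
... | yes _ = s≤s (count≤n (P? ∘ suc))
... | no _  = m≤n⇒m≤1+n (count≤n (P? ∘ suc))

count-mono : ∀ {n} {P Q : Pred (Fin n) ℓ} (P? : Decidable P) (Q? : Decidable Q) → (∀ {i} → P i → Q i) → count P? ≤ count Q?
count-mono {n = zero} P? Q? P⊆Q = z≤n
count-mono {n = suc n} P? Q? P⊆Q with P? zero | Q? zero
... | yes p | no ¬q = contradiction (P⊆Q p) ¬q
... | yes _ | yes _ = s≤s (count-mono (P? ∘ suc) (Q? ∘ suc) P⊆Q)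
... | no _  | yes _ = m≤n⇒m≤1+n (count-mono (P? ∘ suc) (Q? ∘ suc) P⊆Q)
... | no _  | no _  = count-mono (P? ∘ suc) (Q? ∘ suc) P⊆Q

count-disjoint : ∀ {n} {P Q R : Pred (Fin n) ℓ} (P? : Decidable P) (Q? : Decidable Q) (R? : Decidable R) →
  (∀ {i} → P i → R i) → (∀ {i} → Q i → R i) → (∀ {i} → P i → ¬ Q i) →
  count P? + count Q? ≤ count R?
count-disjoint {n = zero} P? Q? R? P⊆R Q⊆R P∩Q=∅ = z≤n
count-disjoint {n = suc n} P? Q? R? P⊆R Q⊆R P∩Q=∅
  with count-disjoint (P? ∘ suc) (Q? ∘ suc) (R? ∘ suc) P⊆R Q⊆R P∩Q=∅ | P? zero | Q? zero | R? zero
... | ih | yes p | yes q | _     = contradiction q (P∩Q=∅ p)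
... | ih | yes p | _     | no ¬r = contradiction (P⊆R p) ¬r
... | ih | _     | yes q | no ¬r = contradiction (Q⊆R q) ¬r
... | ih | yes _ | no _  | yes _ = s≤s ih
... | ih | no _  | yes _ | yes _ = ≤-trans (≤-reflexive (+-suc _ _)) (s≤s ih)
... | ih | no _  | no _  | yes _ = m≤n⇒m≤1+n ih
... | ih | no _  | no _  | no _  = ih

private
  count-remove-suc : ∀ {n} {P : Pred (Fin (suc n)) ℓ} (P? : Decidable P) a →
    count ((P? ∘ suc) ∩? ∁? (_≟ a)) ≤ count ((P? ∩? ∁? (_≟ suc a)) ∘ suc)
  count-remove-suc P? a = count-mono ((P? ∘ suc) ∩? ∁? (_≟ a)) ((P? ∩? ∁? (_≟ suc a)) ∘ suc)
    (λ (p , i≢a) → p , i≢a ∘ suc-injective)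

count-remove : ∀ {n} {P : Pred (Fin n) ℓ} (P? : Decidable P) a → count P? ≤ suc (count (P? ∩? ∁? (_≟ a)))
count-remove {n = suc n} P? a with P? zero | a
... | yes _ | zero  = s≤s (count-mono (P? ∘ suc) ((P? ∩? ∁? (_≟ zero)) ∘ suc) (λ p → p , λ ()))
... | no _  | zero  = m≤n⇒m≤1+n (count-mono (P? ∘ suc) ((P? ∩? ∁? (_≟ zero)) ∘ suc) (λ p → p , λ ()))
... | yes _ | suc a = s≤s (≤-trans (count-remove (P? ∘ suc) a) (s≤s (count-remove-suc P? a)))
... | no _  | suc a = ≤-trans (count-remove (P? ∘ suc) a) (s≤s (count-remove-suc P? a))

choose : ∀ {n} {P : Pred (Fin n) ℓ} → Decidable P → Fin n → Fin n
choose P? x with any? P?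
... | yes (y , _) = y
... | no _        = x

choose-spec : ∀ {n} {P : Pred (Fin n) ℓ} (P? : Decidable P) x → ∃ P → P (choose P? x)
choose-spec P? x ∃P with any? P?
... | yes (_ , Py) = Py
... | no ¬∃P       = contradiction ∃P ¬∃P

Unique-resp-⊇ : {xs ys : List A} → xs ⊆ ys → Unique ys → Unique xs
Unique-resp-⊇ []          []          = []
Unique-resp-⊇ (_ ∷ʳ xs⊆ys) (_ ∷ ys!)   = Unique-resp-⊇ xs⊆ys ys!
Unique-resp-⊇ (refl ∷ xs⊆ys) (y∉ ∷ ys!) = All-resp-⊆ xs⊆ys y∉ ∷ Unique-resp-⊇ xs⊆ys ys!

∉-by : ∀ {P : A → Set} {x xs} → ¬ P x → All P xs → x ∉ xs
∉-by ¬Px Pxs x∈xs = ¬Px (All.lookup Pxs x∈xs)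

module _ {n : ℕ} (G : Graph n) where

  Adj? : ∀ u v → Dec (Adj G u v)
  Adj? u v = T? (adj G u v)

  degree≡count : ∀ v → degree G v ≡ count (Adj? v)
  degree≡count v = cong sum (map-tabulate id (indicator ∘ Adj? v))

  Adj-sym : ∀ {u v} → Adj G u v → Adj G v u
  Adj-sym {u} {v} = subst T (adj-sym G u v)

  Adj-irrefl : ∀ {v} → ¬ Adj G v v
  Adj-irrefl {v} = subst T (irrefl G v)

module _ {n : ℕ} {G : Graph n} where
  open import Data.List.Membership.DecPropositional (_≟_ {n}) using (_∈?_)

  infixr 5 _++ʷ_

  _++ʷ_ : ∀ {u v w} → Walk G u v → Walk G v w → Walk G u w
  nil      ++ʷ q = q
  cons e p ++ʷ q = cons e (p ++ʷ q)

  reverseʷ : ∀ {u v} → Walk G u v → Walk G v u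
  reverseʷ nil        = nil
  reverseʷ (cons e p) = reverseʷ p ++ʷ cons (Adj-sym G e) nil

  labels : (Fin n → Fin n → A) → ∀ {u v} → Walk G u v → List A
  labels κ nil                  = []
  labels κ (cons {u} {w} _ p) = κ u w ∷ labels κ p

  labels-++ʷ : (κ : Fin n → Fin n → A) {u v w : Fin n} (p : Walk G u v) (q : Walk G v w) →
               labels κ (p ++ʷ q) ≡ labels κ p ++ labels κ q
  labels-++ʷ κ nil        q = refl
  labels-++ʷ κ (cons e p) q = cong (_ ∷_) (labels-++ʷ κ p q)

  edgeColours≡labels : ∀ {k} (c : EdgeColouring G k) {u v} (p : Walk G u v) → edgeColours c p ≡ labels (col c) p
  edgeColours≡labels c nil        = refl
  edgeColours≡labels c (cons e p) = cong (_ ∷_) (edgeColours≡labels c p)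

  map-labels : ∀ {B : Set} (f : A → B) {κ : Fin n → Fin n → A} {κ′ : Fin n → Fin n → B} →
               (∀ u v → f (κ u v) ≡ κ′ u v) → ∀ {u v} (w : Walk G u v) → map f (labels κ w) ≡ labels κ′ w
  map-labels f fκ≡κ′ nil                  = refl
  map-labels f fκ≡κ′ (cons {u} {w} _ p) = cong₂ _∷_ (fκ≡κ′ u w) (map-labels f fκ≡κ′ p)

  module _ (κ : Fin n → Fin n → A) (κ-sym : ∀ u v → κ u v ≡ κ v u) where

    ∈-labels-reverseʷ : ∀ {u v x} (p : Walk G u v) → x ∈ labels κ (reverseʷ p) → x ∈ labels κ p
    ∈-labels-reverseʷ (cons {u} {w} e p) x∈
      rewrite labels-++ʷ κ (reverseʷ p) (cons (Adj-sym G e) nil) with ∈-++⁻ (labels κ (reverseʷ p)) x∈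
    ... | inj₁ x∈p       = there (∈-labels-reverseʷ p x∈p)
    ... | inj₂ (here eq) = here (trans eq (κ-sym w u))

    Unique-labels-reverseʷ : ∀ {u v} (p : Walk G u v) → Unique (labels κ p) → Unique (labels κ (reverseʷ p))
    Unique-labels-reverseʷ nil                _           = []
    Unique-labels-reverseʷ (cons {u} {w} e p) (κuw∉ ∷ p!)
      rewrite labels-++ʷ κ (reverseʷ p) (cons (Adj-sym G e) nil) =
      Unique.++⁺ (Unique-labels-reverseʷ p p!) ([] ∷ []) λ where
        (x∈ , here refl) → All.lookup κuw∉ (∈-labels-reverseʷ p x∈) (sym (κ-sym w u))

  module _ (κ : Fin n → Fin n → A) where

    suffix : ∀ {u w v} (q : Walk G w v) → u ∈ vertices q →
             Σ (Walk G u v) λ q′ → (IsPath q → IsPath q′) × labels κ q′ ⊆ labels κ q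
    suffix nil        (here refl) = nil , id , ⊆-refl
    suffix (cons e q) (here refl) = cons e q , id , ⊆-refl
    suffix (cons e q) (there u∈)  with suffix q u∈
    ... | q′ , keep , q′⊆q = q′ , (λ { (_ ∷ q!) → keep q! }) , _ ∷ʳ q′⊆q

    shortcut : ∀ {u v} (p : Walk G u v) → Σ (Walk G u v) λ q → IsPath q × labels κ q ⊆ labels κ p
    shortcut nil = nil , [] ∷ [] , []
    shortcut (cons {u} e p) with shortcut p
    ... | q , q! , q⊆p with u ∈? vertices q
    ...   | yes u∈q = let q′ , keep , q′⊆q = suffix q u∈q in q′ , keep q! , _ ∷ʳ ⊆-trans q′⊆q q⊆p
    ...   | no  u∉q = cons e q , ¬Any⇒All¬ _ u∉q ∷ q! , refl ∷ q⊆p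

  exit-edge : ∀ {P : Pred (Fin n) ℓ} → Decidable P → ∀ {s t} → Walk G s t → P s → ¬ P t →
              ∃₂ λ p q → Adj G p q × P p × ¬ P q
  exit-edge P? nil        Ps ¬Pt = contradiction Ps ¬Pt
  exit-edge P? (cons {u} {w} e p) Ps ¬Pt with P? w
  ... | yes Pw = exit-edge P? p Pw ¬Pt
  ... | no ¬Pw = u , w , e , Ps , ¬Pw

module _ {n : ℕ} (G : Graph n) where

  data Tree : List (Fin n) → Set where
    root  : ∀ r → Tree (r ∷ [])
    graft : ∀ {x p S} → x ∉ S → p ∈ S → Adj G x p → Tree S → Tree (x ∷ S)

  tree-vertex : ∀ {S} → Tree S → ∃ (_∈ S)
  tree-vertex (root r)            = r , here refl
  tree-vertex (graft {x} _ _ _ _) = x , here refl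

  rank : List (Fin n) → Fin n → ℕ
  rank []      y = 0
  rank (x ∷ S) y = if does (y ≟ x) then length S else rank S y

  rank≤length : ∀ S y → rank S y ≤ length S
  rank≤length []      y = z≤n
  rank≤length (x ∷ S) y with y ≟ x
  ... | yes _ = n≤1+n _
  ... | no _  = m≤n⇒m≤1+n (rank≤length S y)

  rank-head : ∀ x S → rank (x ∷ S) x ≡ length S
  rank-head x S with x ≟ x
  ... | yes _  = refl
  ... | no x≢x = contradiction refl x≢x

  rank-tail : ∀ {x y} S → y ≢ x → rank (x ∷ S) y ≡ rank S y
  rank-tail {x} {y} S y≢x with y ≟ x
  ... | yes y≡x = contradiction y≡x y≢x
  ... | no _    = refl

  -- The edge from the last grafted vertex to its parent has a larger colour than every edge
  -- below it, so induction on the tree yields rainbow walks.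
  module _ (κ : Fin n → Fin n → ℕ) (κ-sym : ∀ u v → κ u v ≡ κ v u) where

    RainbowBelow : ℕ → Fin n → Fin n → Set
    RainbowBelow b u v = Σ (Walk G u v) λ w → Unique (labels κ w) × All (_< b) (labels κ w)

    TreeColouring : List (Fin n) → Set
    TreeColouring S = ∀ {y y′} → y ∈ S → y′ ∈ S → κ y y′ ≡ (rank S y ⊔ rank S y′) ∸ 1

    tree-rainbow : ∀ {S u v} → Tree S → TreeColouring S → u ∈ S → v ∈ S → RainbowBelow (length S ∸ 1) u v
    tree-rainbow (root r) _ (here refl) (here refl) = nil , [] , []
    tree-rainbow {x ∷ S} (graft {p = p} x∉S p∈S x~p t) κ-tree = connect
      where
      x≢ : ∀ {y} → y ∈ S → y ≢ x
      x≢ y∈S refl = x∉S y∈S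

      κ-subtree : TreeColouring S
      κ-subtree {y} {y′} y∈S y′∈S = trans (κ-tree (there y∈S) (there y′∈S))
        (cong₂ (λ a b → (a ⊔ b) ∸ 1) (rank-tail S (x≢ y∈S)) (rank-tail S (x≢ y′∈S)))

      κxp : κ x p ≡ length S ∸ 1
      κxp = begin
        κ x p                                      ≡⟨ κ-tree (here refl) (there p∈S) ⟩
        (rank (x ∷ S) x ⊔ rank (x ∷ S) p) ∸ 1      ≡⟨ cong₂ (λ a b → (a ⊔ b) ∸ 1) (rank-head x S) (rank-tail S (x≢ p∈S)) ⟩
        (length S ⊔ rank S p) ∸ 1                  ≡⟨ cong (_∸ 1) (m≥n⇒m⊔n≡m (rank≤length S p)) ⟩
        length S ∸ 1                               ∎
        where open ≡-Reasoning

      weaken : ∀ {xs} → All (_< length S ∸ 1) xs → All (_< length S) xs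
      weaken = All.map (λ c< → <-≤-trans c< (m∸n≤m (length S) 1))

      below : ∀ {v} → RainbowBelow (length S ∸ 1) p v → RainbowBelow (length S) x v
      below (w , w! , w<) =
        cons x~p w ,
        All.map (λ c< κxp≡c → <-irrefl (trans (sym κxp≡c) κxp) c<) w< ∷ w! ,
        subst (_< length S) (sym κxp) (∸-monoʳ-< (s≤s z≤n) (∈-length p∈S)) ∷ weaken w<

      connect : ∀ {u v} → u ∈ x ∷ S → v ∈ x ∷ S → RainbowBelow (length S) u v
      connect (here refl)  (here refl)  = nil , [] , []
      connect (here refl)  (there v∈S)  = below (tree-rainbow t κ-subtree p∈S v∈S)
      connect (there u∈S)  (here refl)  =
        let w , w! , w< = below (tree-rainbow t κ-subtree p∈S u∈S)
        in reverseʷ w , Unique-labels-reverseʷ κ κ-sym w w! ,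
           All.tabulate (All.lookup w< ∘ ∈-labels-reverseʷ κ κ-sym w)
      connect (there u∈S)  (there v∈S)  =
        let w , w! , w< = tree-rainbow t κ-subtree u∈S v∈S in w , w! , weaken w<

module _ {n : ℕ} (G : Graph n) {ℓ} {Q : Pred (Fin n) ℓ} (Q? : Decidable Q) where
  open import Data.List.Membership.DecPropositional (_≟_ {n}) using (_∈?_)

  Alternating : (Fin n → Bool) → Set ℓ
  Alternating χ = ∀ {v y} → Q v → Q y → Adj G v y → ∃[ y′ ] Q y′ × Adj G v y′ × χ y′ ≢ χ v

  private
    Independent : List (Fin n) → Set ℓ
    Independent I = All Q I × (∀ {x y} → x ∈ I → y ∈ I → ¬ Adj G x y)

    Covers : List (Fin n) → Fin n → Set
    Covers I v = v ∈ I ⊎ ∃[ y ] y ∈ I × Adj G v y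

    addable? : ∀ I v → Dec (Q v × ¬ Any (Adj G v) I)
    addable? I v = Q? v ×-dec ¬? (Any.any? (Adj? G v) I)

    greedy : List (Fin n) → List (Fin n) → List (Fin n)
    greedy I []       = I
    greedy I (v ∷ vs) with addable? I v
    ... | yes _ = greedy (v ∷ I) vs
    ... | no _  = greedy I vs

    greedy-⊇ : ∀ {x} I vs → x ∈ I → x ∈ greedy I vs
    greedy-⊇ I []       x∈I = x∈I
    greedy-⊇ I (v ∷ vs) x∈I with addable? I v
    ... | yes _ = greedy-⊇ (v ∷ I) vs (there x∈I)
    ... | no _  = greedy-⊇ I vs x∈I

    greedy-independent : ∀ I vs → Independent I → Independent (greedy I vs)
    greedy-independent I []       ind = ind
    greedy-independent I (v ∷ vs) (QI , indI) with addable? I v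
    ... | no _ = greedy-independent I vs (QI , indI)
    ... | yes (Qv , v≁I) = greedy-independent (v ∷ I) vs (Qv ∷ QI , ind)
      where
      ind : ∀ {x y} → x ∈ v ∷ I → y ∈ v ∷ I → ¬ Adj G x y
      ind (here refl) (here refl) x~y = Adj-irrefl G x~y
      ind (here refl) (there y∈I) x~y = v≁I (lose y∈I x~y)
      ind (there x∈I) (here refl) x~y = v≁I (lose x∈I (Adj-sym G x~y))
      ind (there x∈I) (there y∈I) = indI x∈I y∈I

    greedy-covers : ∀ {v} I vs → v ∈ vs → Q v → Covers (greedy I vs) v
    greedy-covers I (v ∷ vs) v∈ Qv with addable? I v | v∈
    ... | yes _ | here refl = inj₁ (greedy-⊇ (v ∷ I) vs (here refl))
    ... | yes _ | there v∈vs = greedy-covers (v ∷ I) vs v∈vs Qv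
    ... | no _  | there v∈vs = greedy-covers I vs v∈vs Qv
    ... | no ¬ok | here refl with Any.any? (Adj? G v) I
    ...   | yes v~I = let y , y∈I , v~y = find v~I in inj₂ (y , greedy-⊇ I vs y∈I , v~y)
    ...   | no v≁I  = contradiction (Qv , v≁I) ¬ok

  -- χ is the indicator of a maximal independent subset of Q.
  alternating-colouring : ∃ Alternating
  alternating-colouring = (λ v → does (v ∈? I)) , alternates
    where
    I = greedy [] (allFin n)
    I-independent : Independent I
    I-independent = greedy-independent [] (allFin n) ([] , λ ())

    in-I : ∀ {v} → v ∈ I → does (v ∈? I) ≡ true
    in-I = dec-true (_ ∈? I)

    out-I : ∀ {v} → v ∉ I → does (v ∈? I) ≡ false
    out-I = dec-false (_ ∈? I)

    alternates : Alternating (λ v → does (v ∈? I))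
    alternates {v} {y} Qv Qy v~y with v ∈? I
    ... | yes v∈I = y , Qy , v~y , λ χy≡χv →
          contradiction (trans (sym (out-I λ y∈I → proj₂ I-independent v∈I y∈I v~y)) χy≡χv) λ ()
    ... | no v∉I with greedy-covers [] (allFin n) (∈-allFin v) Qv
    ...   | inj₁ v∈I = contradiction v∈I v∉I
    ...   | inj₂ (y′ , y′∈I , v~y′) = y′ , All.lookup (proj₁ I-independent) y′∈I , v~y′ , λ χy′≡χv →
          contradiction (trans (sym (in-I y′∈I)) χy′≡χv) λ ()

module _ {n : ℕ} (G : Graph n) where
  open import Data.List.Membership.DecPropositional (_≟_ {n}) using (_∈?_)

  Dominated : List (Fin n) → Pred (Fin n) 0ℓ
  Dominated D v = v ∈ D ⊎ ∃[ d ] Adj G v d × d ∈ D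

  Within₂ : List (Fin n) → Pred (Fin n) 0ℓ
  Within₂ D v = Dominated D v ⊎ ∃[ a ] Adj G v a × Dominated D a

  Boundary : List (Fin n) → Pred (Fin n) 0ℓ
  Boundary D v = Dominated D v × v ∉ D

  dominated? : ∀ D → Decidable (Dominated D)
  dominated? D v = v ∈? D ⊎-dec any? (λ d → Adj? G v d ×-dec d ∈? D)

  within₂? : ∀ D → Decidable (Within₂ D)
  within₂? D v = dominated? D v ⊎-dec any? (λ a → Adj? G v a ×-dec dominated? D a)

  boundary? : ∀ D → Decidable (Boundary D)
  boundary? D v = dominated? D v ×-dec ¬? (v ∈? D)

  dominated-mono : ∀ {D D′} → (∀ {x} → x ∈ D → x ∈ D′) → ∀ {v} → Dominated D v → Dominated D′ v
  dominated-mono D⊆D′ (inj₁ v∈D)             = inj₁ (D⊆D′ v∈D)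
  dominated-mono D⊆D′ (inj₂ (d , v~d , d∈D)) = inj₂ (d , v~d , D⊆D′ d∈D)

  boundary-anchor : ∀ {D v} → Boundary D v → ∃[ d ] Adj G v d × d ∈ D
  boundary-anchor (inj₁ v∈D , v∉D) = contradiction v∈D v∉D
  boundary-anchor (inj₂ anchor , _) = anchor

  graft-boundary : ∀ {D a} → Boundary D a → Tree G D → Tree G (a ∷ D)
  graft-boundary ba@(_ , a∉D) t = let d , a~d , d∈D = boundary-anchor ba in graft a∉D d∈D a~d t

  -- The three situations in which the greedy construction can enlarge D.
  Far : List (Fin n) → Set
  Far D = ∃[ w ] ¬ Within₂ D w

  OtherLink : List (Fin n) → Fin n → Fin n → Set
  OtherLink D z a = ∃[ a′ ] a′ ≢ a × Boundary D a′ × Adj G z a′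

  otherLink? : ∀ D z a → Dec (OtherLink D z a)
  otherLink? D z a = any? λ a′ → ¬? (a′ ≟ a) ×-dec boundary? D a′ ×-dec Adj? G z a′

  SingleLink : List (Fin n) → Set
  SingleLink D = ∃[ z ] ∃[ a ] ¬ Dominated D z × Boundary D a × Adj G z a × ¬ OtherLink D z a

  OtherAnchor : List (Fin n) → Fin n → Fin n → Set
  OtherAnchor D x d = ∃[ d′ ] d′ ≢ d × d′ ∈ D × Adj G x d′

  otherAnchor? : ∀ D x d → Dec (OtherAnchor D x d)
  otherAnchor? D x d = any? λ d′ → ¬? (d′ ≟ d) ×-dec d′ ∈? D ×-dec Adj? G x d′

  BoundaryNeighbour : List (Fin n) → Fin n → Set
  BoundaryNeighbour D x = ∃[ y ] Boundary D y × Adj G x y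

  boundaryNeighbour? : ∀ D x → Dec (BoundaryNeighbour D x)
  boundaryNeighbour? D x = any? λ y → boundary? D y ×-dec Adj? G x y

  Pendant : List (Fin n) → Set
  Pendant D = ∃[ x ] ∃[ d ] Boundary D x × d ∈ D × Adj G x d × ¬ OtherAnchor D x d × ¬ BoundaryNeighbour D x

  far? : ∀ D → Dec (Far D)
  far? D = any? (¬? ∘ within₂? D)

  singleLink? : ∀ D → Dec (SingleLink D)
  singleLink? D = any? λ z → any? λ a →
    ¬? (dominated? D z) ×-dec boundary? D a ×-dec Adj? G z a ×-dec ¬? (otherLink? D z a)

  pendant? : ∀ D → Dec (Pendant D)
  pendant? D = any? λ x → any? λ d →
    boundary? D x ×-dec d ∈? D ×-dec Adj? G x d ×-dec ¬? (otherAnchor? D x d) ×-dec ¬? (boundaryNeighbour? D x)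

  record Closed (D : List (Fin n)) : Set where
    field
      within₂      : ∀ w → Within₂ D w
      other-link   : ∀ {z a} → ¬ Dominated D z → Boundary D a → Adj G z a → OtherLink D z a
      other-anchor : ∀ {x d} → Boundary D x → d ∈ D → Adj G x d → OtherAnchor D x d ⊎ BoundaryNeighbour D x

  closed : ∀ {D} → ¬ Far D → ¬ SingleLink D → ¬ Pendant D → Closed D
  closed {D} ¬far ¬single ¬pendant = record
    { within₂      = λ w → decidable-stable (within₂? D w) (λ ¬w₂ → ¬far (w , ¬w₂))
    ; other-link   = λ {z} {a} ¬zd ba z~a → decidable-stable (otherLink? D z a)
                       (λ ¬other → ¬single (z , a , ¬zd , ba , z~a , ¬other))
    ; other-anchor = λ {x} {d} bx d∈D x~d → other-anchor bx d∈D x~d (otherAnchor? D x d) (boundaryNeighbour? D x)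
    }
    where
    other-anchor : ∀ {x d} → Boundary D x → d ∈ D → Adj G x d →
      Dec (OtherAnchor D x d) → Dec (BoundaryNeighbour D x) → OtherAnchor D x d ⊎ BoundaryNeighbour D x
    other-anchor _  _   _   (yes other) _         = inj₁ other
    other-anchor _  _   _   (no _)      (yes nbr) = inj₂ nbr
    other-anchor bx d∈D x~d (no ¬other) (no ¬nbr) = contradiction (_ , _ , bx , d∈D , x~d , ¬other , ¬nbr) ¬pendant

module Growth {n : ℕ} (G : Graph n) (connected : Connected G)
              {δ : ℕ} (δ≤degree : ∀ v → δ ≤ degree G v) (2≤δ : 2 ≤ δ) where
  open import Data.List.Membership.DecPropositional (_≟_ {n}) using (_∈?_)

  ∣N[_]∣ : List (Fin n) → ℕ
  ∣N[ D ]∣ = count (dominated? G D)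

  record State : Set where
    field
      D     : List (Fin n)
      tree  : Tree G D
      bound : (length D ∸ 1) * (δ ∸ 1) ≤ 3 * ∣N[ D ]∣

  open State

  Gains : List (Fin n) → List (Fin n) → Set
  Gains D D′ = ∣N[ D ]∣ + (δ ∸ 1) ≤ ∣N[ D′ ]∣

  gain : ∀ {D D′} v e → (∀ {x} → x ∈ D → x ∈ D′) → v ∈ D′ →
         (∀ {i} → Adj G v i → i ≢ e → ¬ Dominated G D i) → Gains D D′
  gain {D} {D′} v e D⊆D′ v∈D′ fresh = begin
    ∣N[ D ]∣ + (δ ∸ 1)  ≤⟨ +-monoʳ-≤ ∣N[ D ]∣ δ-1≤new ⟩
    ∣N[ D ]∣ + count new? ≤⟨ count-disjoint (dominated? G D) new? (dominated? G D′)
                              (dominated-mono G D⊆D′) (λ (v~i , _) → inj₂ (v , Adj-sym G v~i , v∈D′))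
                              (λ i∈N (v~i , i≢e) → fresh v~i i≢e i∈N) ⟩
    ∣N[ D′ ]∣           ∎
    where
    open ≤-Reasoning
    new? = Adj? G v ∩? ∁? (_≟ e)
    δ-1≤new : δ ∸ 1 ≤ count new?
    δ-1≤new = m≤n+o⇒m∸n≤o δ 1
      (≤-trans (δ≤degree v) (≤-trans (≤-reflexive (degree≡count G v)) (count-remove (Adj? G v) e)))

  extend : (s : State) {D′ : List (Fin n)} → Tree G D′ → length D′ ≤ length (D s) + 3 → Gains (D s) D′ →
           Σ State λ s′ → Gains (D s) (D s′)
  extend s {D′} tree′ longer gains = record { D = D′ ; tree = tree′ ; bound = bound′ } , gains
    where
    open ≤-Reasoning
    t = length (D s) ∸ 1
    size-bound : length D′ ∸ 1 ≤ t + 3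
    size-bound with length (D s)
    ... | zero  = ≤-trans (m∸n≤m (length D′) 1) longer
    ... | suc l = m≤n+o⇒m∸n≤o (length D′) 1 longer
    bound′ : (length D′ ∸ 1) * (δ ∸ 1) ≤ 3 * ∣N[ D′ ]∣
    bound′ = begin
      (length D′ ∸ 1) * (δ ∸ 1)        ≤⟨ *-monoˡ-≤ (δ ∸ 1) size-bound ⟩
      (t + 3) * (δ ∸ 1)                ≡⟨ *-distribʳ-+ (δ ∸ 1) t 3 ⟩
      t * (δ ∸ 1) + 3 * (δ ∸ 1)        ≤⟨ +-monoˡ-≤ (3 * (δ ∸ 1)) (bound s) ⟩
      3 * ∣N[ D s ]∣ + 3 * (δ ∸ 1)     ≡⟨ sym (*-distribˡ-+ 3 ∣N[ D s ]∣ (δ ∸ 1)) ⟩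
      3 * (∣N[ D s ]∣ + (δ ∸ 1))       ≤⟨ *-monoʳ-≤ 3 gains ⟩
      3 * ∣N[ D′ ]∣                    ∎

  Step : State → Set
  Step s = Σ State λ s′ → Gains (D s) (D s′)

  -- Any walk from D to a far vertex leaves Within₂ along some edge p q; adding q, p and a dominated
  -- neighbour a of p makes the whole neighbourhood of q newly dominated.
  step-across : (s : State) → ∀ {p q} → Adj G p q → Within₂ G (D s) p → ¬ Within₂ G (D s) q → Step s
  step-across s p~q (inj₁ pd) ¬q₂ = contradiction (inj₂ (_ , Adj-sym G p~q , pd)) ¬q₂
  step-across s {p} {q} p~q (inj₂ (a , p~a , ad)) ¬q₂ = extend s tree′ (≤-reflexive (+-comm 3 _)) gains
    where
    ¬pd : ¬ Dominated G (D s) p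
    ¬pd pd = ¬q₂ (inj₂ (p , Adj-sym G p~q , pd))
    ba : Boundary G (D s) a
    ba = ad , λ a∈D → ¬pd (inj₂ (a , p~a , a∈D))
    tree′ : Tree G (q ∷ p ∷ a ∷ D s)
    tree′ = graft (∉-by ¬q₂ (inj₂ (a , p~a , ad) ∷ inj₁ ad ∷ All.tabulate (inj₁ ∘ inj₁))) (here refl) (Adj-sym G p~q)
           (graft (∉-by ¬pd (ad ∷ All.tabulate inj₁)) (here refl) p~a
           (graft-boundary G ba (tree s)))
    gains : Gains (D s) (q ∷ p ∷ a ∷ D s)
    gains = gain q q (there ∘ there ∘ there) (here refl) λ q~i _ i∈N → ¬q₂ (inj₂ (_ , q~i , i∈N))

  step-far : (s : State) → Far G (D s) → Step s
  step-far s (w , ¬w₂) with tree-vertex G (tree s)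
  ... | x , x∈D with exit-edge (within₂? G (D s)) (proj₁ (connected x w)) (inj₁ (inj₁ x∈D)) ¬w₂
  ...   | _ , _ , p~q , p₂ , ¬q₂ = step-across s p~q p₂ ¬q₂

  step-single-link : (s : State) → SingleLink G (D s) → Step s
  step-single-link s (z , a , ¬zd , ba@(ad , _) , z~a , ¬other) =
    extend s tree′ (≤-trans (n≤1+n _) (≤-reflexive (+-comm 3 _))) gains
    where
    tree′ : Tree G (z ∷ a ∷ D s)
    tree′ = graft (∉-by ¬zd (ad ∷ All.tabulate inj₁)) (here refl) z~a (graft-boundary G ba (tree s))
    gains : Gains (D s) (z ∷ a ∷ D s)
    gains = gain z a (there ∘ there) (here refl) λ {i} z~i i≢a i∈N → case i ∈? D s of λ where
      (yes i∈D) → ¬zd (inj₂ (i , z~i , i∈D))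
      (no i∉D)  → ¬other (i , i≢a , (i∈N , i∉D) , z~i)

  step-pendant : (s : State) → Pendant G (D s) → Step s
  step-pendant s (x , d , (_ , x∉D) , d∈D , x~d , ¬other , ¬nbr) =
    extend s (graft x∉D d∈D x~d (tree s)) (≤-trans (m≤n+m _ 2) (≤-reflexive (+-comm 3 _))) gains
    where
    gains : Gains (D s) (x ∷ D s)
    gains = gain x d there (here refl) λ {i} x~i i≢d i∈N → case i ∈? D s of λ where
      (yes i∈D) → ¬other (i , i≢d , i∈D , x~i)
      (no i∉D)  → ¬nbr (i , (i∈N , i∉D) , x~i)

  fuel-step : ∀ {fuel s s′} → n < ∣N[ D s ]∣ + suc fuel → Gains (D s) (D s′) → n < ∣N[ D s′ ]∣ + fuel
  fuel-step {fuel} {s} n<N gains = <-≤-trans n<N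
    (≤-trans (≤-reflexive (sym (+-assoc ∣N[ D s ]∣ 1 fuel)))
             (+-monoˡ-≤ fuel (≤-trans (+-monoʳ-≤ ∣N[ D s ]∣ (∸-monoˡ-≤ 1 2≤δ)) gains)))

  -- Each step raises ∣N[ D ]∣ ≤ n by δ - 1 ≥ 1, so n + 1 steps of fuel suffice.
  grow : ∀ fuel (s : State) → n < ∣N[ D s ]∣ + fuel → Σ State (Closed G ∘ D)
  continue : ∀ fuel (s : State) → n < ∣N[ D s ]∣ + suc fuel → Step s → Σ State (Closed G ∘ D)

  grow zero s n<N = contradiction
    (≤-trans (≤-reflexive (+-identityʳ _)) (count≤n (dominated? G (D s)))) (<⇒≱ n<N)
  grow (suc fuel) s n<N with far? G (D s) | singleLink? G (D s) | pendant? G (D s)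
  ... | yes far | _          | _        = continue fuel s n<N (step-far s far)
  ... | no _    | yes single | _        = continue fuel s n<N (step-single-link s single)
  ... | no _    | no _       | yes pend = continue fuel s n<N (step-pendant s pend)
  ... | no ¬far | no ¬single | no ¬pend = s , closed G ¬far ¬single ¬pend

  continue fuel s n<N (s′ , gains) = grow fuel s′ (fuel-step {s = s} {s′} n<N gains)

  closed-tree : Fin n → Σ State (Closed G ∘ D)
  closed-tree r = grow (suc n) (record { D = r ∷ [] ; tree = root r ; bound = z≤n }) (m≤n+m (suc n) _)

data Extra : Set where
  to-core     : Bool → Extra
  lateral     : Extra
  to-boundary : Bool → Extra

code : Extra → ℕ
code (to-core false)     = 0
code (to-core true)      = 1
code lateral             = 2
code (to-boundary false) = 3
code (to-boundary true)  = 4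

code<5 : ∀ e → code e < 5
code<5 (to-core false)     = s≤s z≤n
code<5 (to-core true)      = s≤s (s≤s z≤n)
code<5 lateral             = s≤s (s≤s (s≤s z≤n))
code<5 (to-boundary false) = s≤s (s≤s (s≤s (s≤s z≤n)))
code<5 (to-boundary true)  = ≤-refl

code-injective : ∀ {e e′} → code e ≡ code e′ → e ≡ e′
code-injective {e} {e′} eq = trans (sym (decode-code e)) (trans (cong decode eq) (decode-code e′))
  where
  decode : ℕ → Extra
  decode 0 = to-core false
  decode 1 = to-core true
  decode 3 = to-boundary false
  decode 4 = to-boundary true
  decode _ = lateral
  decode-code : ∀ e → decode (code e) ≡ e
  decode-code (to-core false)     = refl
  decode-code (to-core true)      = refl
  decode-code lateral             = refl
  decode-code (to-boundary false) = refl
  decode-code (to-boundary true)  = refl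

data Free (b : Bool) : Extra → Set where
  to-core     : Free b (to-core b)
  to-boundary : Free b (to-boundary b)

data Avoiding (b : Bool) : Extra → Set where
  to-core     : Avoiding b (to-core (not b))
  lateral     : Avoiding b lateral
  to-boundary : Avoiding b (to-boundary (not b))

-- The colours of a route from the boundary that avoids parity b: having no to-boundary colour,
-- such a route can be extended by an edge from an outer vertex.
data Upward (b : Bool) : Extra → Set where
  to-core : Upward b (to-core (not b))
  lateral : Upward b lateral

Free-Avoiding : ∀ {b e} → Free b e → ¬ Avoiding b e
Free-Avoiding {true}  to-core     ()
Free-Avoiding {true}  to-boundary ()
Free-Avoiding {false} to-core     ()
Free-Avoiding {false} to-boundary ()

Upward⇒Avoiding : ∀ {b e} → Upward b e → Avoiding b e
Upward⇒Avoiding to-core = to-core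
Upward⇒Avoiding lateral = lateral

Free⇒Avoiding : ∀ {b c e} → c ≢ b → Free c e → Avoiding b e
Free⇒Avoiding {b} c≢b Fe with ¬-not c≢b
Free⇒Avoiding c≢b to-core     | refl = to-core
Free⇒Avoiding c≢b to-boundary | refl = to-boundary

module Colouring {n : ℕ} (G : Graph n) {D : List (Fin n)} (tree : Tree G D) (closure : Closed G D)
                 (χ : Fin n → Bool) (alternating : Alternating G (boundary? G D) χ) where
  open import Data.List.Membership.DecPropositional (_≟_ {n}) using (_∈?_)
  open Closed closure

  data Layer : Set where
    core boundary outer : Layer

  layer : Fin n → Layer
  layer v with v ∈? D | dominated? G D v
  ... | yes _ | _     = core
  ... | no _  | yes _ = boundary
  ... | no _  | no _  = outer

  layer-core : ∀ {v} → v ∈ D → layer v ≡ core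
  layer-core {v} v∈D with v ∈? D
  ... | yes _   = refl
  ... | no v∉D  = contradiction v∈D v∉D

  layer-boundary : ∀ {v} → Boundary G D v → layer v ≡ boundary
  layer-boundary {v} (vd , v∉D) with v ∈? D | dominated? G D v
  ... | yes v∈D | _      = contradiction v∈D v∉D
  ... | no _    | yes _  = refl
  ... | no _    | no ¬vd = contradiction vd ¬vd

  layer-outer : ∀ {v} → ¬ Dominated G D v → layer v ≡ outer
  layer-outer {v} ¬vd with v ∈? D | dominated? G D v
  ... | yes v∈D | _      = contradiction (inj₁ v∈D) ¬vd
  ... | no _    | yes vd = contradiction vd ¬vd
  ... | no _    | no _   = refl

  anchor : Fin n → Fin n
  anchor v = choose (λ d → d ∈? D ×-dec Adj? G v d) v

  anchor-spec : ∀ {v} → Boundary G D v → anchor v ∈ D × Adj G v (anchor v)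
  anchor-spec {v} bv = let d , v~d , d∈D = boundary-anchor G bv in
    choose-spec (λ d → d ∈? D ×-dec Adj? G v d) v (d , d∈D , v~d)

  link₁ : Fin n → Fin n
  link₁ z = choose (λ a → boundary? G D a ×-dec Adj? G z a) z

  link₁-spec : ∀ {z} → ¬ Dominated G D z → Boundary G D (link₁ z) × Adj G z (link₁ z)
  link₁-spec {z} ¬zd = choose-spec (λ a → boundary? G D a ×-dec Adj? G z a) z (some-link (within₂ z))
    where
    some-link : Within₂ G D z → ∃[ a ] Boundary G D a × Adj G z a
    some-link (inj₁ zd)              = contradiction zd ¬zd
    some-link (inj₂ (a , z~a , ad)) = a , (ad , λ a∈D → ¬zd (inj₂ (a , z~a , a∈D))) , z~a

  link₂ : Fin n → Fin n
  link₂ z = choose (λ a → ¬? (a ≟ link₁ z) ×-dec boundary? G D a ×-dec Adj? G z a) z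

  link₂-spec : ∀ {z} → ¬ Dominated G D z → link₂ z ≢ link₁ z × Boundary G D (link₂ z) × Adj G z (link₂ z)
  link₂-spec {z} ¬zd = choose-spec (λ a → ¬? (a ≟ link₁ z) ×-dec boundary? G D a ×-dec Adj? G z a) z
    (other-link ¬zd (proj₁ (link₁-spec ¬zd)) (proj₂ (link₁-spec ¬zd)))

  m : ℕ
  m = length D ∸ 1

  k : ℕ
  k = m + 5

  extra : Extra → ℕ
  extra e = m + code e

  extra-injective : ∀ {e e′} → extra e ≡ extra e′ → e ≡ e′
  extra-injective = code-injective ∘ +-cancelˡ-≡ m _ _

  to-core-colour : Fin n → Fin n → ℕ
  to-core-colour v d = extra (to-core (if does (d ≟ anchor v) then χ v else not (χ v)))

  to-boundary-colour : Fin n → Fin n → ℕ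
  to-boundary-colour z a =
    if does (a ≟ link₁ z) then extra (to-boundary (χ (link₁ z)))
    else if does (a ≟ link₂ z) then extra (to-boundary (not (χ (link₁ z))))
    else 0

  -- Edges that no route or tree walk uses get the junk colour 0.
  colourBy : Layer → Layer → Fin n → Fin n → ℕ
  colourBy core     core     u v = (rank G D u ⊔ rank G D v) ∸ 1
  colourBy core     boundary d v = to-core-colour v d
  colourBy boundary core     v d = to-core-colour v d
  colourBy boundary boundary _ _ = extra lateral
  colourBy boundary outer    a z = to-boundary-colour z a
  colourBy outer    boundary z a = to-boundary-colour z a
  colourBy _        _        _ _ = 0

  colour : Fin n → Fin n → ℕ
  colour u v = colourBy (layer u) (layer v) u v

  colour-sym : ∀ u v → colour u v ≡ colour v u
  colour-sym u v with layer u | layer v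
  ... | core     | core     = cong (_∸ 1) (⊔-comm (rank G D u) (rank G D v))
  ... | core     | boundary = refl
  ... | core     | outer    = refl
  ... | boundary | core     = refl
  ... | boundary | boundary = refl
  ... | boundary | outer    = refl
  ... | outer    | core     = refl
  ... | outer    | boundary = refl
  ... | outer    | outer    = refl

  extra<k : ∀ e → extra e < k
  extra<k e = +-monoʳ-< m (code<5 e)

  0<k : 0 < k
  0<k = ≤-<-trans z≤n (extra<k lateral)

  to-boundary<k : ∀ z a → to-boundary-colour z a < k
  to-boundary<k z a with does (a ≟ link₁ z) | does (a ≟ link₂ z)
  ... | true  | _     = extra<k _
  ... | false | true  = extra<k _
  ... | false | false = 0<k

  colour<k : ∀ u v → colour u v < k
  colour<k u v with layer u | layer v
  ... | core     | core     =
    ≤-<-trans (∸-monoˡ-≤ 1 (⊔-lub (rank≤length G D u) (rank≤length G D v))) (m<m+n m (s≤s z≤n))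
  ... | core     | boundary = extra<k _
  ... | boundary | core     = extra<k _
  ... | boundary | boundary = extra<k lateral
  ... | boundary | outer    = to-boundary<k v u
  ... | outer    | boundary = to-boundary<k u v
  ... | core     | outer    = 0<k
  ... | outer    | core     = 0<k
  ... | outer    | outer    = 0<k

  colour-core : ∀ {u v} → u ∈ D → v ∈ D → colour u v ≡ (rank G D u ⊔ rank G D v) ∸ 1
  colour-core u∈D v∈D rewrite layer-core u∈D | layer-core v∈D = refl

  colour-lateral : ∀ {v y} → Boundary G D v → Boundary G D y → colour v y ≡ extra lateral
  colour-lateral bv by rewrite layer-boundary bv | layer-boundary by = refl

  colour-anchor : ∀ {v} → Boundary G D v → colour v (anchor v) ≡ extra (to-core (χ v))
  colour-anchor {v} bv rewrite layer-boundary bv | layer-core (proj₁ (anchor-spec bv))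
                             | dec-true (anchor v ≟ anchor v) refl = refl

  colour-other-anchor : ∀ {v d} → Boundary G D v → d ∈ D → d ≢ anchor v → colour v d ≡ extra (to-core (not (χ v)))
  colour-other-anchor {v} {d} bv d∈D d≢ rewrite layer-boundary bv | layer-core d∈D
                                             | dec-false (d ≟ anchor v) d≢ = refl

  colour-link₁ : ∀ {z} → ¬ Dominated G D z → colour z (link₁ z) ≡ extra (to-boundary (χ (link₁ z)))
  colour-link₁ {z} ¬zd rewrite layer-outer ¬zd | layer-boundary (proj₁ (link₁-spec ¬zd))
                             | dec-true (link₁ z ≟ link₁ z) refl = refl

  colour-link₂ : ∀ {z} → ¬ Dominated G D z → colour z (link₂ z) ≡ extra (to-boundary (not (χ (link₁ z))))
  colour-link₂ {z} ¬zd with link₂-spec ¬zd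
  ... | l₂≢l₁ , bl₂ , _ rewrite layer-outer ¬zd | layer-boundary bl₂
                              | dec-false (link₂ z ≟ link₁ z) l₂≢l₁ | dec-true (link₂ z ≟ link₂ z) refl = refl

  IsExtra : (Extra → Set) → ℕ → Set
  IsExtra P c = ∃[ e ] c ≡ extra e × P e

  record Route (P : Extra → Set) (v : Fin n) : Set where
    constructor route
    field
      {end}    : Fin n
      end∈D    : end ∈ D
      walk     : Walk G v end
      distinct : Unique (labels colour walk)
      extras   : All (IsExtra P) (labels colour walk)

  open Route

  stay : ∀ {P v} → v ∈ D → Route P v
  stay v∈D = route v∈D nil [] []

  weaken : ∀ {P Q v} → (∀ {e} → P e → Q e) → Route P v → Route Q v
  weaken P⊆Q (route end∈D w w! ws) = route end∈D w w! (All.map (λ (e , c≡e , Pe) → e , c≡e , P⊆Q Pe) ws)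

  step : ∀ {P Q z a e} → Adj G z a → colour z a ≡ extra e → Q e →
         (∀ {e′} → P e′ → Q e′) → (∀ {e′} → P e′ → e′ ≢ e) → Route P a → Route Q z
  step z~a za≡e Qe P⊆Q P∌e (route end∈D w w! ws) =
    route end∈D (cons z~a w)
      (All.map (λ (e′ , c≡e′ , Pe′) za≡c → P∌e Pe′ (extra-injective (trans (sym c≡e′) (trans (sym za≡c) za≡e)))) ws ∷ w!)
      ((_ , za≡e , Qe) ∷ All.map (λ (e′ , c≡e′ , Pe′) → e′ , c≡e′ , P⊆Q Pe′) ws)

  edge : ∀ {Q v d e} → Adj G v d → d ∈ D → colour v d ≡ extra e → Q e → Route Q v
  edge {Q} v~d d∈D vd≡e Qe = step {P = λ _ → ⊥} v~d vd≡e Qe (λ ()) (λ ()) (stay d∈D)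

  boundary-own : ∀ {v} → Boundary G D v → Route (_≡ to-core (χ v)) v
  boundary-own bv = let anchor∈D , v~anchor = anchor-spec bv in edge v~anchor anchor∈D (colour-anchor bv) refl

  boundary-avoiding : ∀ {v} → Boundary G D v → ∀ b → Route (Upward b) v
  boundary-avoiding {v} bv b with χ v ≟ᵇ b
  ... | no χv≢b = weaken (λ { refl → subst (λ c → Upward b (to-core c)) (sym (¬-not χv≢b)) to-core }) (boundary-own bv)
  ... | yes refl with other-anchor bv (proj₁ (anchor-spec bv)) (proj₂ (anchor-spec bv))
  ...   | inj₁ (d , d≢anchor , d∈D , v~d) = edge v~d d∈D (colour-other-anchor bv d∈D d≢anchor) to-core
  ...   | inj₂ (y₀ , by₀ , v~y₀) with alternating bv by₀ v~y₀
  ...     | y , by , v~y , χy≢χv = step v~y (colour-lateral bv by) lateral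
              (λ { refl → subst (λ c → Upward (χ v) (to-core c)) (sym (¬-not χy≢χv)) to-core }) (λ { refl () })
              (boundary-own by)

  outer-own : ∀ {z} → ¬ Dominated G D z → Route (Free (χ (link₁ z))) z
  outer-own ¬zd = let bl₁ , z~l₁ = link₁-spec ¬zd in
    step z~l₁ (colour-link₁ ¬zd) to-boundary (λ { refl → to-core }) (λ { refl () }) (boundary-own bl₁)

  outer-avoiding : ∀ {z} → ¬ Dominated G D z → ∀ b → Route (Avoiding b) z
  outer-avoiding {z} ¬zd b with χ (link₁ z) ≟ᵇ b
  ... | no c≢b  = weaken (Free⇒Avoiding c≢b) (outer-own ¬zd)
  ... | yes refl = let _ , bl₂ , z~l₂ = link₂-spec ¬zd in
    step z~l₂ (colour-link₂ ¬zd) to-boundary Upward⇒Avoiding (λ { to-core () ; lateral () }) (boundary-avoiding bl₂ b)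

  parity : Fin n → Bool
  parity v with layer v
  ... | core     = true
  ... | boundary = χ v
  ... | outer    = χ (link₁ v)

  route-own : ∀ v → Route (Free (parity v)) v
  route-own v with v ∈? D | dominated? G D v
  ... | yes v∈D | _      = stay v∈D
  ... | no v∉D  | yes vd = weaken (λ { refl → to-core }) (boundary-own (vd , v∉D))
  ... | no _    | no ¬vd = outer-own ¬vd

  route-avoiding : ∀ v b → Route (Avoiding b) v
  route-avoiding v b with v ∈? D | dominated? G D v
  ... | yes v∈D | _      = stay v∈D
  ... | no v∉D  | yes vd = weaken Upward⇒Avoiding (boundary-avoiding (vd , v∉D) b)
  ... | no _    | no ¬vd = outer-avoiding ¬vd b

  rainbow-walk : ∀ u v → Σ (Walk G u v) (Unique ∘ labels colour)
  rainbow-walk u v = walk ru ++ʷ (proj₁ t ++ʷ reverseʷ (walk rv)) , distinct-walk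
    where
    ru = route-own u
    rv = route-avoiding v (parity u)
    t  = tree-rainbow G colour colour-sym tree colour-core (end∈D ru) (end∈D rv)
    back = labels colour (reverseʷ (walk rv))

    back-extra : ∀ {c} → c ∈ back → IsExtra (Avoiding (parity u)) c
    back-extra = All.lookup (extras rv) ∘ ∈-labels-reverseʷ colour colour-sym (walk rv)

    tree-back : ∀ {c} → ¬ (c ∈ labels colour (proj₁ t) × c ∈ back)
    tree-back (c∈t , c∈back) with back-extra c∈back
    ... | e , refl , _ = <⇒≱ (All.lookup (proj₂ (proj₂ t)) c∈t) (m≤m+n m (code e))

    own-rest : ∀ {c} → ¬ (c ∈ labels colour (walk ru) × c ∈ labels colour (proj₁ t) ++ back)
    own-rest (c∈ru , c∈rest) with All.lookup (extras ru) c∈ru | ∈-++⁻ (labels colour (proj₁ t)) c∈rest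
    ... | e , refl , _  | inj₁ c∈t    = <⇒≱ (All.lookup (proj₂ (proj₂ t)) c∈t) (m≤m+n m (code e))
    ... | e , c≡e , Fe | inj₂ c∈back with back-extra c∈back
    ...   | e′ , c≡e′ , Ae′ = Free-Avoiding Fe (subst (Avoiding (parity u)) (extra-injective (trans (sym c≡e′) c≡e)) Ae′)

    distinct-walk : Unique (labels colour (walk ru ++ʷ (proj₁ t ++ʷ reverseʷ (walk rv))))
    distinct-walk rewrite labels-++ʷ colour (walk ru) (proj₁ t ++ʷ reverseʷ (walk rv))
                        | labels-++ʷ colour (proj₁ t) (reverseʷ (walk rv)) =
      Unique.++⁺ (distinct ru)
        (Unique.++⁺ (proj₁ (proj₂ t)) (Unique-labels-reverseʷ colour colour-sym (walk rv) (distinct rv)) tree-back)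
        own-rest

  colouring : EdgeColouring G k
  colouring = record
    { col     = λ u v → fromℕ< (colour<k u v)
    ; col-sym = λ u v _ → toℕ-injective (trans (toℕ-fromℕ< (colour<k u v))
                                        (trans (colour-sym u v) (sym (toℕ-fromℕ< (colour<k v u))))) }

  colouring-rainbow : IsRainbow colouring
  colouring-rainbow u v with rainbow-walk u v
  ... | w , w! with shortcut (col colouring) w
  ...   | p , p-path , p⊆w = p , p-path ,
    subst Unique (sym (edgeColours≡labels colouring p))
      (Unique-resp-⊇ p⊆w (Unique.map⁻ (subst Unique (sym (map-labels toℕ (λ u v → toℕ-fromℕ< (colour<k u v)) w)) w!)))

-- 3δ ≤ 4(δ - 1) for δ ≥ 4, so (t + 5) δ ≤ (4/3) t (δ - 1) + 5δ ≤ 4c + 5n.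
colours-bound : ∀ {t c n δ} → 4 ≤ δ → δ ≤ n → c ≤ n → t * (δ ∸ 1) ≤ 3 * c → (t + 5) * δ ≤ 16 * n
colours-bound {t} {c} {n} {suc d} (s≤s 3≤d) δ≤n c≤n bound = *-cancelˡ-≤ 3 (begin
  3 * ((t + 5) * suc d)          ≡⟨ expand t d ⟩
  t * (3 + 3 * d) + 15 * suc d   ≤⟨ +-monoˡ-≤ (15 * suc d) (*-monoʳ-≤ t (+-monoˡ-≤ (3 * d) 3≤d)) ⟩
  t * (d + 3 * d) + 15 * suc d   ≡⟨ cong (_+ 15 * suc d) (regroup t d) ⟩
  4 * (t * d) + 15 * suc d       ≤⟨ +-mono-≤ (*-monoʳ-≤ 4 bound) (*-monoʳ-≤ 15 δ≤n) ⟩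
  4 * (3 * c) + 15 * n           ≡⟨ cong (_+ 15 * n) (sym (*-assoc 4 3 c)) ⟩
  12 * c + 15 * n                ≤⟨ +-monoˡ-≤ (15 * n) (*-monoʳ-≤ 12 c≤n) ⟩
  12 * n + 15 * n                ≡⟨ sym (*-distribʳ-+ n 12 15) ⟩
  27 * n                         ≤⟨ *-monoˡ-≤ n (m≤m+n 27 21) ⟩
  48 * n                         ≡⟨ *-assoc 3 16 n ⟩
  3 * (16 * n)                   ∎)
  where
  open ≤-Reasoning
  expand : ∀ t d → 3 * ((t + 5) * suc d) ≡ t * (3 + 3 * d) + 15 * suc d
  expand = solve-∀
  regroup : ∀ t d → t * (d + 3 * d) ≡ 4 * (t * d)
  regroup = solve-∀

theorem1 : ∀ (n : ℕ) (G : Graph n) (δ : ℕ) →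
    Connected G → IsMinDegree G δ → 4 ≤ δ →
    Σ ℕ (λ k → (k * δ ≤ 16 * n) × Σ (EdgeColouring G k) IsRainbow)
theorem1 n G δ connected (δ≤degree , v₀ , _) 4≤δ =
  k , colours-bound {t = length D ∸ 1} 4≤δ δ≤n (count≤n (dominated? G D)) (State.bound s) , colouring , colouring-rainbow
  where
  open Growth G connected δ≤degree (≤-trans (s≤s (s≤s z≤n)) 4≤δ)
  grown = closed-tree v₀
  s = proj₁ grown
  D = State.D s
  χ-alternating = alternating-colouring G (boundary? G D)
  open Colouring G (State.tree s) (proj₂ grown) (proj₁ χ-alternating) (proj₂ χ-alternating)
  δ≤n : δ ≤ n
  δ≤n = ≤-trans (δ≤degree v₀) (≤-trans (≤-reflexive (degree≡count G v₀)) (count≤n (Adj? G v₀)))
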